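{- (In BISH.) Let $\sum a_n$ be a permutably convergent series of real numbers, and let $\sigma$ be a permutation of $\mathbf{N}^+$. Then $\sum a_{\sigma(n)}=\sum a_n$.
   Context: Work in Bishop-style constructive mathematics (intuitionistic logic). $\mathbf{N}^+$ is the set of positive integers. A series $\sum a_n$ of real numbers is permutably convergent if for every permutation $\sigma$ of $\mathbf{N}^+$ the series $\sum a_{\sigma(n)}$ converges in $\mathbf{R}$. -}

module Defs where

-- Bishop-style constructive real numbers, built from agda-stdlib rationals.
-- Indices are shifted by one: Bishop's index n ∈ ℕ⁺ is our index n-1 ∈ ℕ.

open import Data.Nat as ℕ using (ℕ; zero; suc)
open import Data.Nat.Coprimality using (1-coprimeTo)
open import Data.Integer as ℤ using (+_)
open import Data.Rational
  using (ℚ; mkℚ; 0ℚ; _+_; _-_; -_; ∣_∣; _≤_)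
open import Data.Rational.Properties as ℚP
import Data.Rational.Unnormalised as ℚᵘ
import Data.Rational.Unnormalised.Properties as ℚᵘP
open import Data.Rational.Solver using (module +-*-Solver)
open import Data.Product using (Σ; ∃; _,_)
open import Function using (_∘_)
open import Function.Bundles using (_↔_; Inverse)
open import Relation.Binary.PropositionalEquality
  using (_≡_; refl; cong; sym)

-- 1/(n+1) as a rational (Bishop's 1/n with n = n+1)

inv : ℕ → ℚ
inv n = mkℚ (+ 1) n (1-coprimeTo (suc n))

Regular : (ℕ → ℚ) → Set
Regular x = ∀ m n → ∣ x m - x n ∣ ≤ inv m + inv n

record ℝ : Set where
  constructor mkℝ
  field
    seq : ℕ → ℚ
    reg : Regular seq
open ℝ public

infix 4 _≃ʳ_
_≃ʳ_ : ℝ → ℝ → Set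
x ≃ʳ y = ∀ n → ∣ seq x n - seq y n ∣ ≤ inv n + inv n

private
  open +-*-Solver

  inv-half : ∀ n → inv (suc (n ℕ.+ n)) + inv (suc (n ℕ.+ n)) ≡ inv n
  inv-half n = toℚᵘ-injective (ℚᵘP.≃-trans (toℚᵘ-homo-+ h h) (ℚᵘ.*≡* eq))
    where
    h = inv (suc (n ℕ.+ n))
    d : ℕ
    d = suc (suc (n ℕ.+ n))
    eq : (+ 1 ℤ.* + d ℤ.+ + 1 ℤ.* + d) ℤ.* + (suc n) ≡ + 1 ℤ.* (+ d ℤ.* + d)
    eq = cong +_ (lemma n)
      where
      open import Data.Nat.Tactic.RingSolver using (solve-∀)
      lemma : ∀ n → (1 ℕ.* suc (suc (n ℕ.+ n)) ℕ.+ 1 ℕ.* suc (suc (n ℕ.+ n))) ℕ.* suc n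
                  ≡ 1 ℕ.* (suc (suc (n ℕ.+ n)) ℕ.* suc (suc (n ℕ.+ n)))
      lemma = solve-∀

  rearr₁ : ∀ a b c d → (a + b) - (c + d) ≡ (a - c) + (b - d)
  rearr₁ = solve 4 (λ a b c d → (a :+ b) :- (c :+ d) := (a :- c) :+ (b :- d)) refl

  rearr₂ : ∀ p q → (p + q) + (p + q) ≡ (p + p) + (q + q)
  rearr₂ = solve 2 (λ p q → (p :+ q) :+ (p :+ q) := (p :+ p) :+ (q :+ q)) refl

  0≤inv : ∀ n → 0ℚ ≤ inv n
  0≤inv n = *≤* (ℤ.+≤+ ℕ.z≤n)
    where open import Data.Rational using (*≤*)

dbl : ℕ → ℕ
dbl n = suc (n ℕ.+ n)

-- sum of reals: (x + y)_n = x_{2n} + y_{2n}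
infixl 6 _+ʳ_
_+ʳ_ : ℝ → ℝ → ℝ
x +ʳ y = mkℝ (λ n → seq x (dbl n) + seq y (dbl n)) r
  where
  r : Regular (λ n → seq x (dbl n) + seq y (dbl n))
  r m n = begin
    ∣ (a + b) - (c + e) ∣            ≡⟨ cong ∣_∣ (rearr₁ a b c e) ⟩
    ∣ (a - c) + (b - e) ∣            ≤⟨ ∣p+q∣≤∣p∣+∣q∣ (a - c) (b - e) ⟩
    ∣ a - c ∣ + ∣ b - e ∣            ≤⟨ +-mono-≤ (reg x (dbl m) (dbl n)) (reg y (dbl m) (dbl n)) ⟩
    (inv (dbl m) + inv (dbl n)) + (inv (dbl m) + inv (dbl n))
                                     ≡⟨ rearr₂ (inv (dbl m)) (inv (dbl n)) ⟩
    (inv (dbl m) + inv (dbl m)) + (inv (dbl n) + inv (dbl n))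
                                     ≡⟨ cong₂ _+_ (inv-half m) (inv-half n) ⟩
    inv m + inv n                    ∎
    where
    open ℚP.≤-Reasoning
    open import Relation.Binary.PropositionalEquality using (cong₂)
    a = seq x (dbl m)
    b = seq y (dbl m)
    c = seq x (dbl n)
    e = seq y (dbl n)

0ʳ : ℝ
0ʳ = mkℝ (λ _ → 0ℚ) (λ m n → +-mono-≤ (0≤inv m) (0≤inv n))

-- partial sums:  partial a n = a_1 + ... + a_n   (0-based: a 0 + ... + a (n-1))
partial : (ℕ → ℝ) → ℕ → ℝ
partial a zero    = 0ʳ
partial a (suc n) = partial a n +ʳ a n

-- |x - y| ≤ ε  for reals x, y and a rational ε (Bishop's order on ℝ,
-- unfolded: for all n, |(x - y)_n| ≤ ε + 2/n, where (x - y)_n = x_{2n} - y_{2n})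
DistLe : ℝ → ℝ → ℚ → Set
DistLe x y ε = ∀ n → ∣ seq x (dbl n) - seq y (dbl n) ∣ ≤ ε + (inv n + inv n)

ConvergesTo : (ℕ → ℝ) → ℝ → Set
ConvergesTo s x = ∀ k → ∃ λ N → ∀ n → N ℕ.≤ n → DistLe (s n) x (inv k)

HasSum : (ℕ → ℝ) → ℝ → Set
HasSum a x = ConvergesTo (partial a) x

Converges : (ℕ → ℝ) → Set
Converges a = Σ ℝ (HasSum a)

Permutation : Set
Permutation = ℕ ↔ ℕ

PermutablyConvergent : (ℕ → ℝ) → Set
PermutablyConvergent a = (σ : Permutation) → Converges (a ∘ Inverse.to σ)

module Submission where

-- Given a permutation σ, we interleave the identity and σ into a single
-- permutation τ of ℕ: its initial segments are built in stages, stage k+1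
-- extending stage k first to a rearrangement of some segment 0, ..., m-1 and
-- then to a rearrangement of some segment σ 0, ..., σ (m′-1).  Because the
-- series is permutably convergent, Σ a (τ n) has a sum u.  A finite sum does
-- not depend on the order of its terms, so the partial sums of Σ a (τ n)
-- coincide at arbitrarily late lengths with those of Σ a n and with those of
-- Σ a (σ n); a convergent sequence that coincides cofinally with another has
-- the same limit, whence s = u = t.

open import Defs
open import Data.Nat using (ℕ)
open import Function using (_∘_)
open import Function.Bundles using (Inverse)
open import Function.Construct.Identity using (↔-id)
open import Data.Product using (proj₁; proj₂)

-- Combinatorics of initial segments of permutations of ℕ.
module Rearrangement where

  open import Data.Nat using (zero; suc; _≤_; _<_; _≤′_; ≤′-reflexive; ≤′-step; _⊔_; _+_; s≤s; z≤n)
  import Data.Nat.Properties as ℕP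
  open import Data.List using (List; []; _∷_; _++_; filter; map; applyUpTo; length)
  import Data.List.Properties as LP
  open import Data.List.Membership.DecPropositional ℕP._≟_ using (_∈_; _∈?_)
  open import Data.List.Membership.Propositional.Properties
    using (∈-++⁻; ∈-++⁺ˡ; ∈-++⁺ʳ; ∈-filter⁻; ∈-filter⁺; ∈-map⁺; ∈-applyUpTo⁺)
  open import Data.List.Membership.Propositional.Properties.WithK using (unique∧set⇒bag)
  open import Data.List.Relation.Binary.BagAndSetEquality using (∼bag⇒↭)
  open import Data.List.Relation.Binary.Subset.Propositional using (_⊆_)
  open import Data.List.Relation.Unary.Unique.Propositional using (Unique; []; _∷_)
  import Data.List.Relation.Unary.Unique.Propositional.Properties as Unique
  open import Data.List.Relation.Unary.Any using (here; there)
  import Data.List.Relation.Unary.All as All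
  open import Data.List.Relation.Binary.Permutation.Propositional using (_↭_)
  open import Data.List.Relation.Binary.Permutation.Propositional.Properties
    using (↭-length)
  open import Data.Product using (∃; _,_; proj₁; proj₂; _×_)
  open import Data.Sum using (inj₁; inj₂)
  open import Data.Empty using (⊥-elim)
  open import Function.Bundles using (_↔_; Injection; mk⇔; mk↔ₛ′)
  open import Function.Properties.Inverse using (↔⇒↣)
  open import Relation.Nullary using (¬?; yes; no)
  open import Relation.Binary.PropositionalEquality
    using (_≡_; refl; cong; cong₂; sym; trans; subst)

  AgreeCofinally : (ℕ → ℕ) → (ℕ → ℕ) → Set
  AgreeCofinally h₁ h₂ = ∀ N → ∃ λ L → N ≤ L × applyUpTo h₁ L ↭ applyUpTo h₂ L

  bound : List ℕ → ℕ
  bound []       = 0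
  bound (x ∷ xs) = suc x ⊔ bound xs

  ∈⇒<bound : ∀ {x xs} → x ∈ xs → x < bound xs
  ∈⇒<bound {x} {_ ∷ xs} (here refl) = ℕP.m≤m⊔n (suc x) (bound xs)
  ∈⇒<bound {_} {y ∷ xs} (there p)   = ℕP.≤-trans (∈⇒<bound p) (ℕP.m≤n⊔m (suc y) (bound xs))

  extend : List ℕ → List ℕ → List ℕ
  extend X Y = X ++ filter (λ z → ¬? (z ∈? X)) Y

  extend-unique : ∀ {X Y} → Unique X → Unique Y → Unique (extend X Y)
  extend-unique {X} {Y} uX uY = Unique.++⁺ uX (Unique.filter⁺ (λ z → ¬? (z ∈? X)) uY)
    λ (z∈X , z∈new) → proj₂ (∈-filter⁻ (λ z → ¬? (z ∈? X)) {xs = Y} z∈new) z∈X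

  extend-⊇ : ∀ {X Y} → Y ⊆ extend X Y
  extend-⊇ {X} {Y} {z} z∈Y with z ∈? X
  ... | yes z∈X = ∈-++⁺ˡ z∈X
  ... | no  z∉X = ∈-++⁺ʳ X (∈-filter⁺ (λ z → ¬? (z ∈? X)) z∈Y z∉X)

  extend-↭ : ∀ {X Y} → Unique X → Unique Y → X ⊆ Y → extend X Y ↭ Y
  extend-↭ {X} {Y} uX uY X⊆Y =
    ∼bag⇒↭ (unique∧set⇒bag (extend-unique uX uY) uY (mk⇔ extend-⊆ extend-⊇))
    where
    extend-⊆ : extend X Y ⊆ Y
    extend-⊆ z∈ext with ∈-++⁻ X z∈ext
    ... | inj₁ z∈X   = X⊆Y z∈X
    ... | inj₂ z∈new = proj₁ (∈-filter⁻ (λ z → ¬? (z ∈? X)) {xs = Y} z∈new)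

  _⊑_ : List ℕ → List ℕ → Set
  X ⊑ Y = ∃ λ Z → X ++ Z ≡ Y

  ⊑-refl : ∀ X → X ⊑ X
  ⊑-refl X = [] , LP.++-identityʳ X

  ⊑-trans : ∀ {X Y W} → X ⊑ Y → Y ⊑ W → X ⊑ W
  ⊑-trans {X} (Z , refl) (Z′ , refl) = Z ++ Z′ , sym (LP.++-assoc X Z Z′)

  ⊑-extend : ∀ X Y → X ⊑ extend X Y
  ⊑-extend X Y = _ , refl

  ⊑-∈ : ∀ {X Y x} → X ⊑ Y → x ∈ X → x ∈ Y
  ⊑-∈ (Z , refl) x∈X = ∈-++⁺ˡ x∈X

  -- The i-th entry of a list (0 when out of range).
  nth : List ℕ → ℕ → ℕ
  nth []       _       = 0
  nth (x ∷ xs) zero    = x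
  nth (x ∷ xs) (suc i) = nth xs i

  nth-⊑ : ∀ {X Y} → X ⊑ Y → ∀ {i} → i < length X → nth Y i ≡ nth X i
  nth-⊑ {x ∷ X} (Z , refl) {zero}  _         = refl
  nth-⊑ {x ∷ X} (Z , refl) {suc i} (s≤s i<X) = nth-⊑ {X} (Z , refl) i<X

  nth-∈ : ∀ X {i} → i < length X → nth X i ∈ X
  nth-∈ (x ∷ X) {zero}  _         = here refl
  nth-∈ (x ∷ X) {suc i} (s≤s i<X) = there (nth-∈ X i<X)

  ∈⇒nth : ∀ {x} X → x ∈ X → ∃ λ i → i < length X × nth X i ≡ x
  ∈⇒nth (x ∷ X) (here refl) = 0 , s≤s z≤n , refl
  ∈⇒nth (y ∷ X) (there x∈X) with ∈⇒nth X x∈X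
  ... | i , i<X , eq = suc i , s≤s i<X , eq

  nth-injective : ∀ {X} → Unique X → ∀ {i j} → i < length X → j < length X
    → nth X i ≡ nth X j → i ≡ j
  nth-injective {x ∷ X} (_ ∷ u) {zero}  {zero}  _ _ _ = refl
  nth-injective {x ∷ X} (x∉X ∷ u) {zero}  {suc j} _ (s≤s j<X) eq =
    ⊥-elim (All.lookup x∉X (nth-∈ X j<X) eq)
  nth-injective {x ∷ X} (x∉X ∷ u) {suc i} {zero}  (s≤s i<X) _ eq =
    ⊥-elim (All.lookup x∉X (nth-∈ X i<X) (sym eq))
  nth-injective {x ∷ X} (_ ∷ u) {suc i} {suc j} (s≤s i<X) (s≤s j<X) eq =
    cong suc (nth-injective u i<X j<X eq)

  applyUpTo-nth : ∀ X (h : ℕ → ℕ) → (∀ {i} → i < length X → h i ≡ nth X i)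
    → applyUpTo h (length X) ≡ X
  applyUpTo-nth []      h agree = refl
  applyUpTo-nth (x ∷ X) h agree =
    cong₂ _∷_ (agree (s≤s z≤n)) (applyUpTo-nth X (h ∘ suc) (agree ∘ s≤s))

  -- The limit of an increasing chain C 0 ⊑ C 1 ⊑ ... of duplicate-free lists
  -- with length (C k) ≥ k: the sequence whose i-th term is the common i-th
  -- entry of all long enough stages.
  module ChainLimit (C : ℕ → List ℕ)
                    (C-grows  : ∀ k → C k ⊑ C (suc k))
                    (C-long   : ∀ k → k ≤ length (C k))
                    (C-unique : ∀ k → Unique (C k)) where

    C-mono : ∀ {k k′} → k ≤ k′ → C k ⊑ C k′
    C-mono = chain ∘ ℕP.≤⇒≤′
      where
      chain : ∀ {k k′} → k ≤′ k′ → C k ⊑ C k′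
      chain (≤′-reflexive refl) = ⊑-refl _
      chain (≤′-step k≤′k′)     = ⊑-trans (chain k≤′k′) (C-grows _)

    -- The i-th entry of stage i+1, which has more than i entries.
    lim : ℕ → ℕ
    lim i = nth (C (suc i)) i

    lim-agrees : ∀ {X k} → X ⊑ C k → ∀ {i} → i < length X → lim i ≡ nth X i
    lim-agrees {X} {k} X⊑Ck {i} i<X = trans
      (sym (nth-⊑ (C-mono (ℕP.m≤n⊔m k (suc i))) (C-long (suc i))))
      (nth-⊑ (⊑-trans X⊑Ck (C-mono (ℕP.m≤m⊔n k (suc i)))) i<X)

    lim-initial : ∀ {X k} → X ⊑ C k → applyUpTo lim (length X) ≡ X
    lim-initial {X} X⊑Ck = applyUpTo-nth X lim (lim-agrees X⊑Ck)

    -- lim i and lim j are distinct entries of one duplicate-free stage.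
    lim-injective : ∀ {i j} → lim i ≡ lim j → i ≡ j
    lim-injective {i} {j} eq = nth-injective (C-unique K) i<K j<K (trans
      (sym (lim-agrees (⊑-refl (C K)) i<K)) (trans eq (lim-agrees (⊑-refl (C K)) j<K)))
      where
      K = suc (i + j)
      i<K : i < length (C K)
      i<K = ℕP.≤-trans (s≤s (ℕP.m≤m+n i j)) (C-long K)
      j<K : j < length (C K)
      j<K = ℕP.≤-trans (s≤s (ℕP.m≤n+m j i)) (C-long K)

    lim-permutation : (∀ y → ∃ λ k → y ∈ C k) → ℕ ↔ ℕ
    lim-permutation occurs = mk↔ₛ′ lim lim⁻¹ lim-lim⁻¹ (λ x → lim-injective (lim-lim⁻¹ (lim x)))
      where
      preimage : ∀ y → ∃ λ i → lim i ≡ y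
      preimage y with occurs y
      ... | k , y∈Ck with ∈⇒nth (C k) y∈Ck
      ... | i , i<Ck , nth≡y = i , trans (lim-agrees (⊑-refl (C k)) i<Ck) nth≡y
      lim⁻¹ : ℕ → ℕ
      lim⁻¹ y = proj₁ (preimage y)
      lim-lim⁻¹ : ∀ y → lim (lim⁻¹ y) ≡ y
      lim-lim⁻¹ y = proj₂ (preimage y)

  -- Extending P by the initial segment σ 0, ..., σ (m-1), with m > k large
  -- enough that this segment contains P.
  module Cover (σ : ℕ ↔ ℕ) where
    open Inverse σ using (to; from; strictlyInverseˡ)

    segment-unique : ∀ m → Unique (applyUpTo to m)
    segment-unique m = Unique.applyUpTo⁺₁ to m
      λ i<j _ eq → ℕP.<⇒≢ i<j (Injection.injective (↔⇒↣ σ) eq)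

    -- The length of the segment used to extend P at step k: beyond k and
    -- beyond σ⁻¹ of every element of P.
    cover-length : ℕ → List ℕ → ℕ
    cover-length k P = bound (map from P) ⊔ suc k

    cover : ℕ → List ℕ → List ℕ
    cover k P = extend P (applyUpTo to (cover-length k P))

    ⊑-cover : ∀ k P → P ⊑ cover k P
    ⊑-cover k P = ⊑-extend P (applyUpTo to (cover-length k P))

    -- Every z ∈ P is σ (σ⁻¹ z) with σ⁻¹ z below the segment length.
    P⊆segment : ∀ k P → P ⊆ applyUpTo to (cover-length k P)
    P⊆segment k P {z} z∈P = subst (_∈ applyUpTo to (cover-length k P)) (strictlyInverseˡ z)
      (∈-applyUpTo⁺ to (ℕP.≤-trans (∈⇒<bound (∈-map⁺ from z∈P)) (ℕP.m≤m⊔n _ (suc k))))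

    cover-unique : ∀ k {P} → Unique P → Unique (cover k P)
    cover-unique k {P} uP = extend-unique uP (segment-unique (cover-length k P))

    cover-↭segment : ∀ k {P} → Unique P → cover k P ↭ applyUpTo to (cover-length k P)
    cover-↭segment k {P} uP = extend-↭ uP (segment-unique (cover-length k P)) (P⊆segment k P)

    length-cover : ∀ k {P} → Unique P → length (cover k P) ≡ cover-length k P
    length-cover k {P} uP = trans (↭-length (cover-↭segment k uP))
                                  (LP.length-applyUpTo to (cover-length k P))

    cover-↭ : ∀ k {P} → Unique P → cover k P ↭ applyUpTo to (length (cover k P))
    cover-↭ k {P} uP = subst (λ m → cover k P ↭ applyUpTo to m) (sym (length-cover k uP))
                         (cover-↭segment k uP)

    cover-long : ∀ k {P} → Unique P → suc k ≤ length (cover k P)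
    cover-long k {P} uP = subst (suc k ≤_) (sym (length-cover k uP)) (ℕP.m≤n⊔m _ (suc k))

    cover-∋ : ∀ k P → to k ∈ cover k P
    cover-∋ k P = extend-⊇ {P} {applyUpTo to (cover-length k P)}
      (∈-applyUpTo⁺ to (ℕP.≤-trans (ℕP.n<1+n k) (ℕP.m≤n⊔m _ (suc k))))

  -- Interleaving two permutations σ₁, σ₂ of ℕ: stage k+1 extends stage k
  -- first to a rearranged initial segment of σ₁, then to one of σ₂.
  module Interleave (σ₁ σ₂ : ℕ ↔ ℕ) where
    module C₁ = Cover σ₁
    module C₂ = Cover σ₂

    stage : ℕ → List ℕ
    stage zero    = []
    stage (suc k) = C₂.cover k (C₁.cover k (stage k))

    stage-unique : ∀ k → Unique (stage k)
    stage-unique zero    = []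
    stage-unique (suc k) = C₂.cover-unique k (C₁.cover-unique k (stage-unique k))

    stage-grows : ∀ k → stage k ⊑ stage (suc k)
    stage-grows k = ⊑-trans (C₁.⊑-cover k (stage k)) (C₂.⊑-cover k (C₁.cover k (stage k)))

    stage-long : ∀ k → k ≤ length (stage k)
    stage-long zero    = z≤n
    stage-long (suc k) = C₂.cover-long k (C₁.cover-unique k (stage-unique k))

    open ChainLimit stage stage-grows stage-long stage-unique

    -- y = σ₁ (σ₁⁻¹ y) is covered at stage σ₁⁻¹ y + 1.
    occurs : ∀ y → ∃ λ k → y ∈ stage k
    occurs y = suc k , ⊑-∈ (C₂.⊑-cover k (C₁.cover k (stage k)))
      (subst (_∈ C₁.cover k (stage k)) (Inverse.strictlyInverseˡ σ₁ y) (C₁.cover-∋ k (stage k)))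
      where k = Inverse.from σ₁ y

    τ : ℕ ↔ ℕ
    τ = lim-permutation occurs

    agreement-at : ∀ {X k} h {N} → X ⊑ stage k → X ↭ applyUpTo h (length X) → N ≤ length X
      → ∃ λ L → N ≤ L × applyUpTo lim L ↭ applyUpTo h L
    agreement-at {X} {k} h X⊑stage X↭h N≤X =
      length X , N≤X , subst (_↭ applyUpTo h (length X)) (sym (lim-initial {X} {k} X⊑stage)) X↭h

    -- The σ₁-part of stage N+1 and the whole stage N+1 witness the agreement.
    τ-agrees₁ : AgreeCofinally (Inverse.to τ) (Inverse.to σ₁)
    τ-agrees₁ N = agreement-at {k = suc N} (Inverse.to σ₁)
                    (C₂.⊑-cover N (C₁.cover N (stage N))) (C₁.cover-↭ N uN)
                    (ℕP.≤-trans (ℕP.n≤1+n N) (C₁.cover-long N uN))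
      where uN = stage-unique N

    τ-agrees₂ : AgreeCofinally (Inverse.to τ) (Inverse.to σ₂)
    τ-agrees₂ N = agreement-at {k = suc N} (Inverse.to σ₂) (⊑-refl (stage (suc N)))
                    (C₂.cover-↭ N (C₁.cover-unique N (stage-unique N)))
                    (ℕP.≤-trans (ℕP.n≤1+n N) (stage-long (suc N)))

-- Closeness of reals, finite sums, and sums of rearranged series.
module SeriesOfReals where

  open Rearrangement using (AgreeCofinally)
  open import Data.Nat as ℕ using (zero; suc)
  open import Data.Integer as ℤ using (+_)
  import Data.Nat.Properties as ℕP
  open import Data.Rational using (ℚ; mkℚ; 0ℚ; _+_; _-_; -_; ∣_∣; _≤_; *≤*)
  open import Data.Rational.Properties as ℚP
    using (≤-reflexive; +-mono-≤; +-monoˡ-≤; +-monoʳ-≤; +-assoc; +-comm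
          ; +-identityˡ; +-identityʳ; ∣p+q∣≤∣p∣+∣q∣; ∣-p∣≡∣p∣; module ≤-Reasoning)
  import Data.Rational.Unnormalised as ℚᵘ
  import Data.Rational.Unnormalised.Properties as ℚᵘP
  open import Data.Rational.Solver using (module +-*-Solver)
  open import Data.Product using (∃; _,_; proj₁; proj₂; _×_)
  open import Data.Empty using (⊥-elim)
  open import Relation.Binary.PropositionalEquality
    using (_≡_; refl; cong; cong₂; sym; trans; subst)
  open import Relation.Binary.Structures using (IsEquivalence)
  open import Relation.Binary.Bundles using (Setoid)
  open import Data.List using (List; []; _∷_; map; applyUpTo; applyDownFrom; reverse)
  open import Data.List.Properties using (reverse-applyUpTo; map-applyUpTo)
  open import Data.List.Relation.Binary.Permutation.Propositional as Perm
    using (_↭_; ↭-sym; ↭-trans; module PermutationReasoning)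
  open import Data.List.Relation.Binary.Permutation.Propositional.Properties
    using (↭-reverse; map⁺)
  import Relation.Binary.Reasoning.Setoid as ≈-Reasoning
  open import Data.Nat.Tactic.RingSolver using (solve-∀)
  open +-*-Solver

  -- The precision inv n = 1/(n+1) halves at the index dbl n = 2n+1; the proof
  -- is the cross-multiplication identity (2n+2 + 2n+2)(n+1) = (2n+2)(2n+2).
  inv-half : ∀ n → inv (dbl n) + inv (dbl n) ≡ inv n
  inv-half n = ℚP.toℚᵘ-injective (ℚᵘP.≃-trans (ℚP.toℚᵘ-homo-+ h h) (ℚᵘ.*≡* (cong +_ (cross n))))
    where
    h = inv (dbl n)
    cross : ∀ n → (1 ℕ.* suc (suc (n ℕ.+ n)) ℕ.+ 1 ℕ.* suc (suc (n ℕ.+ n))) ℕ.* suc n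
                ≡ 1 ℕ.* (suc (suc (n ℕ.+ n)) ℕ.* suc (suc (n ℕ.+ n)))
    cross = solve-∀

  0≤inv : ∀ n → 0ℚ ≤ inv n
  0≤inv n = *≤* (ℤ.+≤+ ℕ.z≤n)

  p≤p+q : ∀ p {q} → 0ℚ ≤ q → p ≤ p + q
  p≤p+q p {q} 0≤q = subst (_≤ p + q) (+-identityʳ p) (+-monoʳ-≤ p 0≤q)

  inv-dbl≤inv : ∀ n → inv (dbl n) ≤ inv n
  inv-dbl≤inv n = subst (inv (dbl n) ≤_) (inv-half n) (p≤p+q _ (0≤inv (dbl n)))

  -- Three quarters of inv k stay below inv k; this is the slack available
  -- after refining an index twice.
  three-quarters : ∀ k → let c = inv (dbl (dbl k)) in (c + c) + c ≤ inv k
  three-quarters k = begin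
    (c + c) + c         ≤⟨ p≤p+q _ (0≤inv (dbl (dbl k))) ⟩
    ((c + c) + c) + c   ≡⟨ solve 1 (λ c → ((c :+ c) :+ c) :+ c := (c :+ c) :+ (c :+ c)) refl c ⟩
    (c + c) + (c + c)   ≡⟨ cong₂ _+_ (inv-half (dbl k)) (inv-half (dbl k)) ⟩
    inv (dbl k) + inv (dbl k) ≡⟨ inv-half k ⟩
    inv k               ∎
    where
    open ≤-Reasoning
    c = inv (dbl (dbl k))

  -- Archimedean property: a rational below every inv k is at most 0.  A
  -- positive fraction (p+1)/(d+1) exceeds inv (d+1) = 1/(d+2).
  ≤-inv⇒≤0 : ∀ d → (∀ k → d ≤ inv k) → d ≤ 0ℚ
  ≤-inv⇒≤0 (mkℚ (+ zero)    _  _) _ = *≤* (ℤ.+≤+ ℕ.z≤n)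
  ≤-inv⇒≤0 (mkℚ ℤ.-[1+ _ ]  _  _) _ = *≤* ℤ.-≤+
  ≤-inv⇒≤0 (mkℚ (+ suc p)   dm _) h with h (suc dm)
  ... | *≤* (ℤ.+≤+ le) = ⊥-elim (ℕP.n≮n (suc dm) (begin-strict
    suc dm                    <⟨ ℕP.n<1+n (suc dm) ⟩
    suc (suc dm)              ≤⟨ ℕP.m≤n*m (suc (suc dm)) (suc p) ⟩
    suc p ℕ.* suc (suc dm)    ≤⟨ le ⟩
    1 ℕ.* suc dm              ≡⟨ ℕP.*-identityˡ (suc dm) ⟩
    suc dm                    ∎))
    where open ℕP.≤-Reasoning

  ≤-inv⇒≤ : ∀ q r → (∀ k → q ≤ r + inv k) → q ≤ r
  ≤-inv⇒≤ q r h = begin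
    q             ≡⟨ solve 2 (λ q r → q := (q :- r) :+ r) refl q r ⟩
    (q - r) + r   ≤⟨ +-monoˡ-≤ r (≤-inv⇒≤0 (q - r) q-r≤inv) ⟩
    0ℚ + r        ≡⟨ +-identityˡ r ⟩
    r             ∎
    where
    open ≤-Reasoning
    q-r≤inv : ∀ k → q - r ≤ inv k
    q-r≤inv k = subst (q - r ≤_) (solve 2 (λ r i → (r :+ i) :- r := i) refl r (inv k))
                  (+-monoˡ-≤ (- r) (h k))

  dist-triangle : ∀ p q r → ∣ p - r ∣ ≤ ∣ p - q ∣ + ∣ q - r ∣
  dist-triangle p q r = subst (λ z → ∣ z ∣ ≤ ∣ p - q ∣ + ∣ q - r ∣)
    (solve 3 (λ p q r → (p :- q) :+ (q :- r) := p :- r) refl p q r)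
    (∣p+q∣≤∣p∣+∣q∣ (p - q) (q - r))

  dist-sym : ∀ p q → ∣ p - q ∣ ≡ ∣ q - p ∣
  dist-sym p q = trans (cong ∣_∣ (solve 2 (λ p q → p :- q := :- (q :- p)) refl p q))
                       (∣-p∣≡∣p∣ (q - p))

  -- x ≈[ ε ] y is Bishop's |x - y| ≤ ε, read componentwise:
  -- |x_n - y_n| ≤ ε + 2 inv n for every index n.  A record, so that x and y
  -- can be inferred from a proof.
  infix 4 _≈[_]_ _≈_
  record _≈[_]_ (x : ℝ) (ε : ℚ) (y : ℝ) : Set where
    constructor within
    field at : ∀ n → ∣ seq x n - seq y n ∣ ≤ ε + (inv n + inv n)
  open _≈[_]_

  _≈_ : ℝ → ℝ → Set
  x ≈ y = x ≈[ 0ℚ ] y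

  ≈⇒≃ʳ : ∀ {x y} → x ≈ y → x ≃ʳ y
  ≈⇒≃ʳ {x} {y} p n = subst (∣ seq x n - seq y n ∣ ≤_) (+-identityˡ (inv n + inv n)) (at p n)

  pointwise⇒≈ : ∀ {x y} → (∀ n → seq x n ≡ seq y n) → x ≈ y
  pointwise⇒≈ {x} {y} e = within λ n → begin
    ∣ seq x n - seq y n ∣   ≡⟨ cong (λ z → ∣ seq x n - z ∣) (sym (e n)) ⟩
    ∣ seq x n - seq x n ∣   ≡⟨ cong ∣_∣ (solve 1 (λ a → a :- a := con 0ℚ) refl (seq x n)) ⟩
    0ℚ                      ≤⟨ p≤p+q 0ℚ (+-mono-≤ (0≤inv n) (0≤inv n)) ⟩
    0ℚ + (inv n + inv n)    ∎
    where open ≤-Reasoning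

  -- Bishop's criterion: x ≈[ ε ] y holds as soon as, for every k, a single
  -- index j satisfies |x_j - y_j| + 2 inv j ≤ ε + inv k; regularity spreads
  -- this estimate to every index, and the Archimedean property removes inv k.
  ≈[]-criterion : ∀ {x y ε}
    → (∀ k → ∃ λ j → ∣ seq x j - seq y j ∣ + (inv j + inv j) ≤ ε + inv k)
    → x ≈[ ε ] y
  ≈[]-criterion {x} {y} {ε} w =
    within λ n → ≤-inv⇒≤ _ _ λ k → spread n k (proj₁ (w k)) (proj₂ (w k))
    where
    open ≤-Reasoning
    spread : ∀ n k j → ∣ seq x j - seq y j ∣ + (inv j + inv j) ≤ ε + inv k
      → ∣ seq x n - seq y n ∣ ≤ (ε + (inv n + inv n)) + inv k
    spread n k j p = begin
      ∣ xn - yn ∣                                  ≤⟨ dist-triangle xn xj yn ⟩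
      ∣ xn - xj ∣ + ∣ xj - yn ∣
        ≤⟨ +-monoʳ-≤ ∣ xn - xj ∣ (dist-triangle xj yj yn) ⟩
      ∣ xn - xj ∣ + (∣ xj - yj ∣ + ∣ yj - yn ∣)
        ≤⟨ +-mono-≤ (reg x n j) (+-monoʳ-≤ ∣ xj - yj ∣ (reg y j n)) ⟩
      (inv n + inv j) + (∣ xj - yj ∣ + (inv j + inv n))
        ≡⟨ solve 3 (λ a b d → (a :+ b) :+ (d :+ (b :+ a)) := (d :+ (b :+ b)) :+ (a :+ a))
                 refl (inv n) (inv j) ∣ xj - yj ∣ ⟩
      (∣ xj - yj ∣ + (inv j + inv j)) + (inv n + inv n) ≤⟨ +-monoˡ-≤ (inv n + inv n) p ⟩
      (ε + inv k) + (inv n + inv n)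
        ≡⟨ solve 3 (λ e a b → (e :+ a) :+ b := (e :+ b) :+ a) refl ε (inv k) (inv n + inv n) ⟩
      (ε + (inv n + inv n)) + inv k                ∎
      where
      xn = seq x n
      yn = seq y n
      xj = seq x j
      yj = seq y j

  ≈[]-limit : ∀ {x y ε} → (∀ k → x ≈[ ε + inv k ] y) → x ≈[ ε ] y
  ≈[]-limit {ε = ε} h = within λ n → ≤-inv⇒≤ _ _ λ k → subst (_ ≤_)
    (solve 3 (λ e a b → (e :+ a) :+ b := (e :+ b) :+ a) refl ε (inv k) (inv n + inv n))
    (at (h k) n)

  ≈[]-sym : ∀ {x y ε} → x ≈[ ε ] y → y ≈[ ε ] x
  ≈[]-sym {x} {y} p = within λ n → subst (_≤ _) (dist-sym (seq x n) (seq y n)) (at p n)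

  -- Closeness is transitive with added errors (via the criterion at index
  -- dbl (dbl (dbl k)), where six error terms fit into inv k).
  ≈[]-trans : ∀ {x y z ε δ} → x ≈[ ε ] y → y ≈[ δ ] z → x ≈[ ε + δ ] z
  ≈[]-trans {x} {y} {z} {ε} {δ} p q = ≈[]-criterion λ k → dbl (dbl (dbl k)) , estimate k
    where
    open ≤-Reasoning
    estimate : ∀ k → let j = dbl (dbl (dbl k)) in
      ∣ seq x j - seq z j ∣ + (inv j + inv j) ≤ (ε + δ) + inv k
    estimate k = begin
      ∣ xj - zj ∣ + b                   ≤⟨ +-monoˡ-≤ b (dist-triangle xj (seq y j) zj) ⟩
      (∣ xj - seq y j ∣ + ∣ seq y j - zj ∣) + b ≤⟨ +-monoˡ-≤ b (+-mono-≤ (at p j) (at q j)) ⟩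
      ((ε + b) + (δ + b)) + b
        ≡⟨ solve 3 (λ e d b → ((e :+ b) :+ (d :+ b)) :+ b := (e :+ d) :+ ((b :+ b) :+ b))
                 refl ε δ b ⟩
      (ε + δ) + ((b + b) + b)
        ≡⟨ cong (λ c → (ε + δ) + ((c + c) + c)) (inv-half (dbl (dbl k))) ⟩
      (ε + δ) + ((c + c) + c)            ≤⟨ +-monoʳ-≤ (ε + δ) (three-quarters k) ⟩
      (ε + δ) + inv k                    ∎
      where
      j = dbl (dbl (dbl k))
      xj = seq x j
      zj = seq z j
      b = inv j + inv j
      c = inv (dbl (dbl k))

  DistLe⇒≈[] : ∀ {x y ε} → DistLe x y ε → x ≈[ ε ] y
  DistLe⇒≈[] {x} {y} {ε} h = ≈[]-criterion λ k → dbl (dbl (dbl k)) , estimate k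
    where
    open ≤-Reasoning
    estimate : ∀ k → let m = dbl (dbl k) in
      ∣ seq x (dbl m) - seq y (dbl m) ∣ + (inv (dbl m) + inv (dbl m)) ≤ ε + inv k
    estimate k = begin
      ∣ seq x (dbl m) - seq y (dbl m) ∣ + (inv (dbl m) + inv (dbl m))
                                  ≤⟨ +-mono-≤ (h m) (≤-reflexive (inv-half m)) ⟩
      (ε + (c + c)) + c           ≡⟨ +-assoc ε (c + c) c ⟩
      ε + ((c + c) + c)           ≤⟨ +-monoʳ-≤ ε (three-quarters k) ⟩
      ε + inv k                   ∎
      where
      m = dbl (dbl k)
      c = inv m

  ≈[0+0]⇒≈ : ∀ {x y} → x ≈[ 0ℚ + 0ℚ ] y → x ≈ y
  ≈[0+0]⇒≈ {x} {y} = subst (x ≈[_] y) (+-identityˡ 0ℚ)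

  ≈-isEquivalence : IsEquivalence _≈_
  ≈-isEquivalence = record
    { refl  = pointwise⇒≈ (λ _ → refl)
    ; sym   = ≈[]-sym
    ; trans = λ p q → ≈[0+0]⇒≈ (≈[]-trans p q)
    }

  ℝ-setoid : Setoid _ _
  ℝ-setoid = record { isEquivalence = ≈-isEquivalence }

  open IsEquivalence ≈-isEquivalence public
    using () renaming (refl to ≈-refl; sym to ≈-sym; trans to ≈-trans)

  +ʳ-cong-≈[] : ∀ {x x′ y y′ ε δ} → x ≈[ ε ] x′ → y ≈[ δ ] y′ → x +ʳ y ≈[ ε + δ ] x′ +ʳ y′
  +ʳ-cong-≈[] {x} {x′} {y} {y′} {ε} {δ} p q = within λ n → let d = dbl n in begin
    ∣ (seq x d + seq y d) - (seq x′ d + seq y′ d) ∣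
      ≡⟨ cong ∣_∣ (solve 4 (λ a b a′ b′ → (a :+ b) :- (a′ :+ b′) := (a :- a′) :+ (b :- b′))
                     refl (seq x d) (seq y d) (seq x′ d) (seq y′ d)) ⟩
    ∣ (seq x d - seq x′ d) + (seq y d - seq y′ d) ∣
      ≤⟨ ∣p+q∣≤∣p∣+∣q∣ (seq x d - seq x′ d) (seq y d - seq y′ d) ⟩
    ∣ seq x d - seq x′ d ∣ + ∣ seq y d - seq y′ d ∣
      ≤⟨ +-mono-≤ (at p d) (at q d) ⟩
    (ε + (inv d + inv d)) + (δ + (inv d + inv d))
      ≡⟨ solve 3 (λ e f i → (e :+ i) :+ (f :+ i) := (e :+ f) :+ (i :+ i)) refl ε δ (inv d + inv d) ⟩
    (ε + δ) + ((inv d + inv d) + (inv d + inv d))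
      ≡⟨ cong (λ i → (ε + δ) + (i + i)) (inv-half n) ⟩
    (ε + δ) + (inv n + inv n) ∎
    where open ≤-Reasoning

  +ʳ-comm : ∀ x y → x +ʳ y ≈ y +ʳ x
  +ʳ-comm x y = pointwise⇒≈ λ n → +-comm (seq x (dbl n)) (seq y (dbl n))

  -- Associativity compares representatives at the indices dbl n and
  -- dbl (dbl n); regularity bounds the mismatch by inv (dbl n) + inv n.
  +ʳ-assoc : ∀ x y z → (x +ʳ y) +ʳ z ≈ x +ʳ (y +ʳ z)
  +ʳ-assoc x y z = within λ n → let d = dbl n ; dd = dbl (dbl n) in begin
    ∣ ((seq x dd + seq y dd) + seq z d) - (seq x d + (seq y dd + seq z dd)) ∣
      ≡⟨ cong ∣_∣ (solve 5 (λ a a′ b c c′ → ((a′ :+ b) :+ c) :- (a :+ (b :+ c′))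
                                         := (a′ :- a) :+ (c :- c′))
                     refl (seq x d) (seq x dd) (seq y dd) (seq z d) (seq z dd)) ⟩
    ∣ (seq x dd - seq x d) + (seq z d - seq z dd) ∣
      ≤⟨ ∣p+q∣≤∣p∣+∣q∣ (seq x dd - seq x d) (seq z d - seq z dd) ⟩
    ∣ seq x dd - seq x d ∣ + ∣ seq z d - seq z dd ∣
      ≤⟨ +-mono-≤ (reg x dd d) (reg z d dd) ⟩
    (inv dd + inv d) + (inv d + inv dd)
      ≡⟨ solve 2 (λ a b → (a :+ b) :+ (b :+ a) := (a :+ a) :+ (b :+ b)) refl (inv dd) (inv d) ⟩
    (inv dd + inv dd) + (inv d + inv d)
      ≡⟨ cong₂ _+_ (inv-half d) (inv-half n) ⟩
    inv d + inv n
      ≤⟨ +-monoˡ-≤ (inv n) (inv-dbl≤inv n) ⟩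
    inv n + inv n
      ≡⟨ +-identityˡ (inv n + inv n) ⟨
    0ℚ + (inv n + inv n) ∎
    where open ≤-Reasoning

  sumʳ : List ℝ → ℝ
  sumʳ []       = 0ʳ
  sumʳ (x ∷ xs) = sumʳ xs +ʳ x

  sumʳ-↭ : ∀ {xs ys} → xs ↭ ys → sumʳ xs ≈ sumʳ ys
  sumʳ-↭ Perm.refl             = ≈-refl
  sumʳ-↭ (Perm.prep x p)       = ≈[0+0]⇒≈ (+ʳ-cong-≈[] (sumʳ-↭ p) (≈-refl {x}))
  sumʳ-↭ (Perm.swap {xs} {ys} x y p) = begin
    (sumʳ xs +ʳ y) +ʳ x     ≈⟨ +ʳ-assoc (sumʳ xs) y x ⟩
    sumʳ xs +ʳ (y +ʳ x)     ≈⟨ ≈[0+0]⇒≈ (+ʳ-cong-≈[] (sumʳ-↭ p) (+ʳ-comm y x)) ⟩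
    sumʳ ys +ʳ (x +ʳ y)     ≈⟨ +ʳ-assoc (sumʳ ys) x y ⟨
    (sumʳ ys +ʳ x) +ʳ y     ∎
    where open ≈-Reasoning ℝ-setoid
  sumʳ-↭ (Perm.trans p q)      = ≈-trans (sumʳ-↭ p) (sumʳ-↭ q)

  partial≡sumʳ : ∀ a n → partial a n ≡ sumʳ (applyDownFrom a n)
  partial≡sumʳ a zero    = refl
  partial≡sumʳ a (suc n) =
    cong (_+ʳ a n) {partial a n} {sumʳ (applyDownFrom a n)} (partial≡sumʳ a n)

  applyDownFrom↭map : ∀ (a : ℕ → ℝ) h L → applyDownFrom (a ∘ h) L ↭ map a (applyUpTo h L)
  applyDownFrom↭map a h L = begin
    applyDownFrom (a ∘ h) L              ≡⟨ reverse-applyUpTo (a ∘ h) L ⟨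
    reverse (applyUpTo (a ∘ h) L)        ↭⟨ ↭-reverse (applyUpTo (a ∘ h) L) ⟩
    applyUpTo (a ∘ h) L                  ≡⟨ map-applyUpTo h a L ⟨
    map a (applyUpTo h L)                ∎
    where open PermutationReasoning

  partial-↭ : ∀ (a : ℕ → ℝ) h₁ h₂ L → applyUpTo h₁ L ↭ applyUpTo h₂ L
    → partial (a ∘ h₁) L ≈ partial (a ∘ h₂) L
  partial-↭ a h₁ h₂ L p = begin
    partial (a ∘ h₁) L                 ≡⟨ partial≡sumʳ (a ∘ h₁) L ⟩
    sumʳ (applyDownFrom (a ∘ h₁) L)    ≈⟨ sumʳ-↭ terms-↭ ⟩
    sumʳ (applyDownFrom (a ∘ h₂) L)    ≡⟨ partial≡sumʳ (a ∘ h₂) L ⟨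
    partial (a ∘ h₂) L                 ∎
    where
    open ≈-Reasoning ℝ-setoid
    terms-↭ : applyDownFrom (a ∘ h₁) L ↭ applyDownFrom (a ∘ h₂) L
    terms-↭ = ↭-trans (applyDownFrom↭map a h₁ L)
                (↭-trans (map⁺ a p) (↭-sym (applyDownFrom↭map a h₂ L)))

  ≈[]-respʳ-≈ : ∀ {x y z ε} → x ≈[ ε ] y → y ≈ z → x ≈[ ε ] z
  ≈[]-respʳ-≈ {x} {y} {z} {ε} p q = subst (x ≈[_] z) (+-identityʳ ε) (≈[]-trans p q)

  limits-agree : ∀ s₁ s₂ {u v} → ConvergesTo s₁ u → ConvergesTo s₂ v
    → (∀ N → ∃ λ L → N ℕ.≤ L × s₁ L ≈ s₂ L) → u ≈ v
  limits-agree s₁ s₂ {u} {v} c₁ c₂ meet = ≈[]-limit close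
    where
    close : ∀ k → u ≈[ 0ℚ + inv k ] v
    close k with c₁ (dbl k) | c₂ (dbl k)
    ... | N₁ , late₁ | N₂ , late₂ with meet (N₁ ℕ.+ N₂)
    ... | L , N≤L , s₁≈s₂ = subst (u ≈[_] v) (trans (inv-half k) (sym (+-identityˡ (inv k))))
          (≈[]-trans (≈[]-respʳ-≈ (≈[]-sym s₁≈u) s₁≈s₂) s₂≈v)
      where
      s₁≈u : s₁ L ≈[ inv (dbl k) ] u
      s₁≈u = DistLe⇒≈[] (late₁ L (ℕP.≤-trans (ℕP.m≤m+n N₁ N₂) N≤L))
      s₂≈v : s₂ L ≈[ inv (dbl k) ] v
      s₂≈v = DistLe⇒≈[] (late₂ L (ℕP.≤-trans (ℕP.m≤n+m N₂ N₁) N≤L))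

  sums-agree : ∀ a {h₁ h₂ u v} → AgreeCofinally h₁ h₂
    → HasSum (a ∘ h₁) u → HasSum (a ∘ h₂) v → u ≈ v
  sums-agree a {h₁} {h₂} agree c₁ c₂ = limits-agree (partial (a ∘ h₁)) (partial (a ∘ h₂)) c₁ c₂ meet
    where
    meet : ∀ N → ∃ λ L → N ℕ.≤ L × partial (a ∘ h₁) L ≈ partial (a ∘ h₂) L
    meet N with agree N
    ... | L , N≤L , same = L , N≤L , partial-↭ a h₁ h₂ L same

open Rearrangement using (module Interleave)
open SeriesOfReals using (_≈_; ≈-sym; ≈-trans; ≈⇒≃ʳ; sums-agree)

corollary2p6 : (a : ℕ → ℝ) → PermutablyConvergent a → (σ : Permutation)
    → (s t : ℝ) → HasSum a s → HasSum (a ∘ Inverse.to σ) t → t ≃ʳ s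
corollary2p6 a rearrangeable σ s t a→s aσ→t = ≈⇒≃ʳ (≈-trans (≈-sym u≈t) u≈s)
  where
  open Interleave (↔-id ℕ) σ using (τ; τ-agrees₁; τ-agrees₂)
  u : ℝ
  u = proj₁ (rearrangeable τ)
  aτ→u : HasSum (a ∘ Inverse.to τ) u
  aτ→u = proj₂ (rearrangeable τ)
  u≈s : u ≈ s
  u≈s = sums-agree a τ-agrees₁ aτ→u a→s
  u≈t : u ≈ t
  u≈t = sums-agree a τ-agrees₂ aτ→u aσ→t
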